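{- Let $U$ be a set of evidence items, let $D(1),D(2),\dots\subseteq U$ be a retrieval procedure, let $\mathcal{Q}$ be a class of queries over $U$, and let $\mathsf{WC}(\cdot)$ be a witness certificate assignment (each query $q$ is assigned a finite set $\mathsf{WC}(q)\subseteq U$). Suppose that: (i) the retrieval procedure is monotone, i.e. $D(k)\subseteq D(k+1)$ for all $k\ge1$; (ii) $\mathsf{WC}(\cdot)$ is sound (for all queries $q$ and all depths $k\ge1$, $\mathsf{WC}(q)\subseteq D(k)$ implies $\mathrm{Feas}(q,k)$) and limit-complete (for all queries $q$, $\mathrm{Feas}(q,\infty)$ implies $\mathsf{WC}(q)\subseteq D(\infty)$); (iii) $\mathcal{Q}$ is finitely generated, i.e. there is a finite set $G\subseteq U$ with $\mathsf{WC}(q)\subseteq G$ for all $q\in\mathcal{Q}$; and (iv) $\mathrm{Feas}(q,\infty)$ holds for every $q\in\mathcal{Q}$. Then there exists $K\ge1$ such that $\mathrm{Feas}(q,K)$ holds for all $q\in\mathcal{Q}$.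
   Context: A query $q$ over $U$ consists of a finite slot set $V(q)=\{1,\dots,m_q\}$, admissible sets $A_i(q)\subseteq U$ for $i\in V(q)$, and a compatibility relation $\mathcal{R}_q \subseteq A_1(q)\times\cdots\times A_{m_q}(q)$; a witness for $q$ is a tuple $(a_1,\dots,a_{m_q})\in\mathcal{R}_q$. A retrieval procedure is a sequence of sets $D(k)\subseteq U$ defined for all $k\ge1$, and $D(\infty):=\bigcup_{k\ge1}D(k)$. For $k\in\{1,2,\dots\}\cup\{\infty\}$, put $D_i(q,k):=A_i(q)\cap D(k)$; $q$ is feasible at depth $k$, written $\mathrm{Feas}(q,k)$, if there is a witness $(a_1,\dots,a_{m_q})\in\mathcal{R}_q$ with $a_i\in D_i(q,k)$ for all $i\in V(q)$. -}

module Defs where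

open import Data.Nat using (ℕ; suc; _≤_)
open import Data.Fin using (Fin)
open import Data.Product using (Σ; _×_; ∃)
open import Data.List using (List)
open import Data.List.Membership.Propositional using (_∈_)

Subset : Set → Set₁
Subset U = U → Set

-- A query over U: slots V(q) = Fin m (i.e. {1,…,m} up to renaming),
-- admissible sets A i, and a compatibility relation R on m-tuples
-- (tuples = functions Fin m → U) with R ⊆ A 1 × … × A m.
record Query (U : Set) : Set₁ where
  field
    m   : ℕ
    A   : Fin m → Subset U
    R   : (Fin m → U) → Set
    R⊆A : ∀ a → R a → ∀ i → A i (a i)
open Query public

-- A retrieval procedure: D k ⊆ U; only k ≥ 1 are meaningful (k = 0 ignored).
Retrieval : Set → Set₁
Retrieval U = ℕ → Subset U

D∞ : {U : Set} → Retrieval U → Subset U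
D∞ D x = Σ ℕ λ k → (1 ≤ k) × D k x

FeasIn : {U : Set} → Query U → Subset U → Set
FeasIn {U} q S = Σ (Fin (m q) → U) λ a → R q a × (∀ i → A q i (a i) × S (a i))

Feas : {U : Set} → Retrieval U → Query U → ℕ → Set
Feas D q k = FeasIn q (D k)

Feas∞ : {U : Set} → Retrieval U → Query U → Set
Feas∞ D q = FeasIn q (D∞ D)

_⊆ₗ_ : {U : Set} → List U → Subset U → Set
xs ⊆ₗ S = ∀ {x} → x ∈ xs → S x

_⊆ₗₗ_ : {U : Set} → List U → List U → Set
xs ⊆ₗₗ ys = ∀ {x} → x ∈ xs → x ∈ ys

-- Each element of G
-- that is retrieved at all is retrieved at some finite depth (deciding which
-- elements are retrieved at all is where excluded middle enters), so the
-- maximum K of these depths works for all of G simultaneously by monotonicity.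
-- At depth K every certificate is then retrieved, by limit-completeness and
-- the standing assumption Feas(q, ∞), and soundness gives Feas(q, K).
module Submission where

open import Defs
open import Data.Nat using (ℕ; suc; _≤_; _⊔_; _≤′_; ≤′-refl; ≤′-step)
open import Data.Nat.Properties using (≤⇒≤′; ≤′⇒≤; m≤m⊔n; m≤n⊔m; ≤-refl; ≤-trans)
open import Data.Product using (Σ; _×_; _,_)
open import Data.List using (List; []; _∷_)
open import Data.List.Membership.Propositional using (_∈_)
open import Data.List.Relation.Unary.Any using (here; there)
open import Relation.Binary.PropositionalEquality using (refl)
open import Relation.Nullary using (yes; no; contradiction)
open import Level using (0ℓ)
open import Axiom.ExcludedMiddle using (ExcludedMiddle)

Monotone : {U : Set} → Retrieval U → Set
Monotone D = ∀ k → 1 ≤ k → ∀ {x} → D k x → D (suc k) x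

module _ {U : Set} {D : Retrieval U} (mono : Monotone D) where

  monotone-≤′ : ∀ {k K x} → 1 ≤ k → k ≤′ K → D k x → D K x
  monotone-≤′ 1≤k ≤′-refl       d = d
  monotone-≤′ 1≤k (≤′-step k≤K) d =
    mono _ (≤-trans 1≤k (≤′⇒≤ k≤K)) (monotone-≤′ 1≤k k≤K d)

  monotone-≤ : ∀ {k K x} → 1 ≤ k → k ≤ K → D k x → D K x
  monotone-≤ 1≤k k≤K = monotone-≤′ 1≤k (≤⇒≤′ k≤K)

  finite-stabilisation : ExcludedMiddle 0ℓ → (G : List U) →
    Σ ℕ λ K → (1 ≤ K) × (∀ {x} → x ∈ G → D∞ D x → D K x)
  finite-stabilisation lem [] = 1 , ≤-refl , λ ()
  finite-stabilisation lem (y ∷ ys) with finite-stabilisation lem ys | lem {D∞ D y}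
  ... | K , 1≤K , stable | yes (k , 1≤k , y∈Dk) =
    K ⊔ k , ≤-trans 1≤K (m≤m⊔n K k) , stable′
    where
      stable′ : ∀ {x} → x ∈ y ∷ ys → D∞ D x → D (K ⊔ k) x
      stable′ (here refl) _  = monotone-≤ 1≤k (m≤n⊔m K k) y∈Dk
      stable′ (there x∈ys) x∈D∞ = monotone-≤ 1≤K (m≤m⊔n K k) (stable x∈ys x∈D∞)
  ... | K , 1≤K , stable | no y∉D∞ = K , 1≤K , stable′
    where
      stable′ : ∀ {x} → x ∈ y ∷ ys → D∞ D x → D K x
      stable′ (here refl) y∈D∞  = contradiction y∈D∞ y∉D∞
      stable′ (there x∈ys) x∈D∞ = stable x∈ys x∈D∞

theorem4p2 : ExcludedMiddle 0ℓ →
    {U : Set} (D : Retrieval U) (𝒬 : Query U → Set) (WC : Query U → List U) →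
    (∀ k → 1 ≤ k → ∀ {x} → D k x → D (suc k) x) →
    (∀ q → 𝒬 q → ∀ k → 1 ≤ k → WC q ⊆ₗ D k → Feas D q k) →
    (∀ q → 𝒬 q → Feas∞ D q → WC q ⊆ₗ D∞ D) →
    (Σ (List U) λ G → ∀ q → 𝒬 q → WC q ⊆ₗₗ G) →
    (∀ q → 𝒬 q → Feas∞ D q) →
    Σ ℕ λ K → (1 ≤ K) × (∀ q → 𝒬 q → Feas D q K)
theorem4p2 lem D 𝒬 WC mono sound complete (G , generated) feasible∞
  with finite-stabilisation mono lem G
... | K , 1≤K , stable = K , 1≤K , feasibleAtK
  where
    feasibleAtK : ∀ q → 𝒬 q → Feas D q K
    feasibleAtK q q∈𝒬 = sound q q∈𝒬 K 1≤K λ x∈WC →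
      stable (generated q q∈𝒬 x∈WC) (complete q q∈𝒬 (feasible∞ q q∈𝒬) x∈WC)
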